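{- Let $D$ be a diagram and $i,c\ge 1$, and suppose $L_{i,c}$ acts initially on $D$. Then every cell to which $L_{i,c}$ moves a cell (i.e. every cell $(r',c+1)$ added by one of its ladder moves) lies in the $(i,c+1)$-initial segment of $L_{i,c}(D)$.
   Context: A diagram is a finite subset of $\mathbb{Z}_{>0}\times\mathbb{Z}_{>0}$; $(r,c)$ is the cell in row $r$ (row 1 on top), column $c$. Ladder moves. Let $D$ be a diagram, $i\ge1$, $(r,c)\in D$. A ladder move below row $i$ can be performed at $(r,c)$ if $(r,c+1)\notin D$ and there is $r'$ with $i\le r'<r$ such that $(r',c)\notin D$, $(r',c+1)\notin D$ and $(s,c),(s,c+1)\in D$ for all $r'<s<r$ (such $r'$ is unique). The regular ladder move replaces $D$ by $(D\setminus\{(r,c)\})\cup\{(r',c+1)\}$; the K-ladder move replaces $D$ by $D\cup\{(r',c+1)\}$; in both cases $(r,c)$ is said to be moved to $(r',c+1)$. Operator $L_{i,c}$. Given $D$, scan the cells of column $c$ in rows $\ge i$ from top to bottom (in the current diagram); whenever the current cell admits a ladder move below row $i$, perform the regular ladder move. After finishing the column, if at least one move was performed, turn the last one into a K-ladder move. The result is $L_{i,c}(D)$. $L_{i,c}$ acts initially on $D$ if $L_{i+1,c}(D)=D$. The $(i,c)$-initial segment of a diagram $E$ is the set of cells $(r,c)$ such that $(r',c)\in E$ for all $i\le r'\le r$. -}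

module Defs where

open import Data.Nat using (ℕ; zero; suc; _+_; _∸_; _≤_; _<_; _⊔_; _≡ᵇ_; _<ᵇ_)
open import Data.Bool using (Bool; true; false; _∧_; not; if_then_else_)
open import Data.Product using (_×_; _,_; proj₁; proj₂)
open import Data.List using (List; []; _∷_; filter; map; upTo; foldl; foldr; reverse)
open import Data.Maybe using (Maybe; just; nothing)
open import Relation.Nullary using (¬_)
open import Relation.Binary.PropositionalEquality using (_≡_)

-- A diagram: a finite set of cells (row , column), given by a list
-- (duplicates irrelevant; only membership matters).
Cell : Set
Cell = ℕ × ℕ

Diagram : Set
Diagram = List Cell

_∈ᵇ_ : Cell → Diagram → Bool
(r , c) ∈ᵇ [] = false
(r , c) ∈ᵇ ((r₁ , c₁) ∷ D) = ((r ≡ᵇ r₁) ∧ (c ≡ᵇ c₁)) ∨' ((r , c) ∈ᵇ D)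
  where
  _∨'_ : Bool → Bool → Bool
  true ∨' _ = true
  false ∨' b = b

_∈D_ : Cell → Diagram → Set
x ∈D D = x ∈ᵇ D ≡ true

_≈D_ : Diagram → Diagram → Set
D ≈D E = ∀ x → x ∈ᵇ D ≡ x ∈ᵇ E

Positive : Diagram → Set
Positive D = ∀ r c → (r , c) ∈D D → (1 ≤ r) × (1 ≤ c)

remove : Cell → Diagram → Diagram
remove (r , c) = filter (λ x → Data.Bool.T? (not (((proj₁ x) ≡ᵇ r) ∧ ((proj₂ x) ≡ᵇ c))))
  where import Data.Bool

maxRow : Diagram → ℕ
maxRow = foldr (λ x m → proj₁ x ⊔ m) 0

-- Search for the (unique) r' of a ladder move below row i at (r , c):
-- going upward from row s, skip rows where both (s,c),(s,c+1) ∈ D;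
-- the first row not of that form must have both cells absent and be ≥ i.
-- `findR' D i c s` examines rows s, s-1, ..., i.
findR' : Diagram → ℕ → ℕ → ℕ → Maybe ℕ
findR' D i c zero = nothing
findR' D i c (suc s) with suc s <ᵇ i
... | true = nothing
... | false with (suc s , c) ∈ᵇ D | (suc s , suc c) ∈ᵇ D
...   | true  | true  = findR' D i c s
...   | false | false = just (suc s)
...   | _     | _     = nothing

-- The target row r' of a ladder move below row i at (r , c), if the move
-- can be performed (requires (r,c) ∈ D and (r,c+1) ∉ D).
ladder : Diagram → ℕ → ℕ → ℕ → Maybe ℕ
ladder D i r c with (r , c) ∈ᵇ D | (r , suc c) ∈ᵇ D
... | true | false = findR' D i c (r ∸ 1)
... | _    | _     = nothing

-- One move record: source row r and target row r' (cell (r,c) moved to (r',c+1)).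
Move : Set
Move = ℕ × ℕ

-- Scan rows in the given (increasing) order, performing regular ladder
-- moves; accumulates the moves in reverse order (latest first).
scan : ℕ → ℕ → List ℕ → Diagram × List Move → Diagram × List Move
scan i c [] st = st
scan i c (r ∷ rs) (D , ms) with ladder D i r c
... | nothing = scan i c rs (D , ms)
... | just r' = scan i c rs ((r' , suc c) ∷ remove (r , c) D , (r , r') ∷ ms)

-- rows i, i+1, ..., maxRow D  (no cell of column c lies below maxRow D,
-- and moves never create cells in column c)
rowsFrom : ℕ → Diagram → List ℕ
rowsFrom i D = map (i +_) (upTo (suc (maxRow D) ∸ i))

Lrun : ℕ → ℕ → Diagram → Diagram × List Move
Lrun i c D = scan i c (rowsFrom i D) (D , [])

-- L_{i,c}(D): the last move is turned into a K-ladder move, i.e. its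
-- source cell (r,c) is kept.
L : ℕ → ℕ → Diagram → Diagram
L i c D with Lrun i c D
... | (E , [])          = E
... | (E , (r , _) ∷ _) = (r , c) ∷ E

MovedTo : ℕ → ℕ → Diagram → Cell → Set
MovedTo i c D x = Data.List.Membership.Propositional._∈_ x
                    (map (λ m → (proj₂ m , suc c)) (proj₂ (Lrun i c D)))
  where import Data.List.Membership.Propositional

ActsInitially : ℕ → ℕ → Diagram → Set
ActsInitially i c D = L (suc i) c D ≈D D

InInitialSegment : ℕ → ℕ → Diagram → Cell → Set
InInitialSegment i c E (r , c') =
  (c' ≡ c) × (∀ r₁ → i ≤ r₁ → r₁ ≤ r → (r₁ , c) ∈D E)

module Submission where

-- Scanning column c downwards from row i, we keep the invariant that every ladder move below
-- row i whose source row has not yet been scanned lands on a row s such that column c+1 is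
-- filled in rows i, …, s−1.  At the start this holds because L_{i,c} acts initially: a ladder
-- move with s > i is also a ladder move below row i+1, and L_{i+1,c} would then add a new cell
-- to column c+1.  A move (r,c) ↦ (r',c+1) performed during the scan therefore leaves column
-- c+1 filled from row i to r'.  It preserves the invariant: a later ladder move landing on
-- row r has the rows r'+1, …, r−1 as rungs, and every other later ladder move was already
-- available before the move.  Cells of column c+1 are never removed, and the final K-ladder
-- move only adds a cell.

open import Defs
open import Data.Nat using (ℕ; zero; suc; _≤_; _<_; _+_; _∸_; _≡ᵇ_; _<ᵇ_; z≤n; s≤s)
open import Data.Nat.Properties
open import Data.Bool using (true; false; _∧_; T)
open import Data.Bool.Properties using (T-≡; T-∧; ¬-not; not-¬)
open import Data.Product using (_×_; _,_; proj₁; proj₂; ∃; uncurry)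
open import Data.Sum using (_⊎_; inj₁; inj₂)
open import Data.List using (List; []; _∷_; applyUpTo; iterate)
open import Data.List.Properties using (map-upTo)
open import Data.List.Relation.Unary.All as All using (All; []; _∷_)
open import Data.List.Relation.Unary.Any using (here; there)
open import Data.List.Membership.Propositional using (_∈_)
open import Data.List.Membership.Propositional.Properties using (∈-map⁺; ∈-map⁻; ∈-upTo⁺)
open import Data.Maybe using (just; nothing)
open import Data.Unit using (tt)
open import Function using (_∘_)
open import Function.Bundles using (Equivalence)
open import Relation.Nullary using (¬_; yes; no; contradiction)
open import Relation.Binary.PropositionalEquality

infix 4 _∉D_

_∉D_ : Cell → Diagram → Set
x ∉D D = ¬ x ∈D D

≡ᵇ-refl : ∀ n → (n ≡ᵇ n) ≡ true
≡ᵇ-refl n = Equivalence.to T-≡ (≡⇒≡ᵇ n n refl)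

cell-≡ᵇ⇒≡ : ∀ r c r₁ c₁ → ((r ≡ᵇ r₁) ∧ (c ≡ᵇ c₁)) ≡ true → (r , c) ≡ (r₁ , c₁)
cell-≡ᵇ⇒≡ r c r₁ c₁ eq with Equivalence.to T-∧ (Equivalence.from T-≡ eq)
... | r≡r₁ , c≡c₁ = cong₂ _,_ (≡ᵇ⇒≡ r r₁ r≡r₁) (≡ᵇ⇒≡ c c₁ c≡c₁)

∈D-here : ∀ x E → x ∈D (x ∷ E)
∈D-here (r , c) E rewrite ≡ᵇ-refl r | ≡ᵇ-refl c = refl

∈D-there : ∀ x y E → x ∈D E → x ∈D (y ∷ E)
∈D-there (r , c) (r₁ , c₁) E x∈E with (r ≡ᵇ r₁) ∧ (c ≡ᵇ c₁)
... | true  = refl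
... | false = x∈E

∈D-∷⁻ : ∀ {x y} E → x ∈D (y ∷ E) → x ≡ y ⊎ x ∈D E
∈D-∷⁻ {r , c} {r₁ , c₁} E x∈ with (r ≡ᵇ r₁) ∧ (c ≡ᵇ c₁) in eq
... | true  = inj₁ (cell-≡ᵇ⇒≡ r c r₁ c₁ eq)
... | false = inj₂ x∈

∈D-remove⁻ : ∀ {x} y E → x ∈D remove y E → x ∈D E
∈D-remove⁻ {_ , _} _ [] ()
∈D-remove⁻ {x} (r , c) ((a , b) ∷ E) x∈ with (a ≡ᵇ r) ∧ (b ≡ᵇ c)
... | true = ∈D-there x (a , b) E (∈D-remove⁻ (r , c) E x∈)
... | false with ∈D-∷⁻ {x} {a , b} (remove (r , c) E) x∈
...   | inj₁ refl = ∈D-here (a , b) E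
...   | inj₂ x∈E  = ∈D-there x (a , b) E (∈D-remove⁻ (r , c) E x∈E)

∈D-remove⁺ : ∀ {x y} E → x ≢ y → x ∈D E → x ∈D remove y E
∈D-remove⁺ {_ , _} [] _ ()
∈D-remove⁺ {x} {r , c} ((a , b) ∷ E) x≢y x∈
  with (a ≡ᵇ r) ∧ (b ≡ᵇ c) in eq | ∈D-∷⁻ {x} {a , b} E x∈
... | true  | inj₁ refl = contradiction (cell-≡ᵇ⇒≡ a b r c eq) x≢y
... | true  | inj₂ x∈E  = ∈D-remove⁺ E x≢y x∈E
... | false | inj₁ refl = ∈D-here (a , b) (remove (r , c) E)
... | false | inj₂ x∈E  = ∈D-there x (a , b) (remove (r , c) E) (∈D-remove⁺ E x≢y x∈E)

FullRow : Diagram → ℕ → ℕ → Set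
FullRow D c u = (u , c) ∈D D × (u , suc c) ∈D D

EmptyRow : Diagram → ℕ → ℕ → Set
EmptyRow D c u = (u , c) ∉D D × (u , suc c) ∉D D

-- findR' never returns row 0, hence the field `positive`.
record LadderTarget (D : Diagram) (i c r r' : ℕ) : Set where
  field
    positive : 1 ≤ r'
    below    : i ≤ r'
    above    : r' < r
    empty    : EmptyRow D c r'
    rungs    : ∀ u → r' < u → u < r → FullRow D c u

record LadderMove (D : Diagram) (i c r r' : ℕ) : Set where
  field
    source   : (r , c) ∈D D
    source∉  : (r , suc c) ∉D D
    target   : LadderTarget D i c r r'

module _ {D i c r r'} (l : LadderTarget D i c r r') where
  open LadderTarget l

  LadderTarget-extend : FullRow D c r → LadderTarget D i c (suc r) r'
  LadderTarget-extend full = record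
    { positive = positive ; below = below ; above = m<n⇒m<1+n above
    ; empty = empty ; rungs = rungs′ }
    where
    rungs′ : ∀ u → r' < u → u < suc r → FullRow D c u
    rungs′ u r'<u u≤r with m≤n⇒m<n∨m≡n (≤-pred u≤r)
    ... | inj₁ u<r  = rungs u r'<u u<r
    ... | inj₂ refl = full

  LadderTarget-shorten : ∀ {s} → r' < s → s ≤ r → LadderTarget D i c s r'
  LadderTarget-shorten r'<s s≤r =
    record { positive = positive ; below = below ; above = r'<s ; empty = empty
           ; rungs = λ u r'<u u<s → rungs u r'<u (<-≤-trans u<s s≤r) }

LadderMove-below : ∀ {D i j c r r'} → j ≤ r' → LadderMove D i c r r' → LadderMove D j c r r'
LadderMove-below j≤r' m = record
  { source = source ; source∉ = source∉
  ; target = record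
    { positive = positive ; below = j≤r' ; above = above ; empty = empty ; rungs = rungs } }
  where
  open LadderMove m
  open LadderTarget target

findR'-sound : ∀ D i c s {r'} → findR' D i c s ≡ just r' → LadderTarget D i c (suc s) r'
findR'-sound D i c zero ()
findR'-sound D i c (suc s) h with suc s <ᵇ i in s<i
findR'-sound D i c (suc s) () | true
... | false with (suc s , c) ∈ᵇ D in e₁ | (suc s , suc c) ∈ᵇ D in e₂
...   | true  | true  = LadderTarget-extend (findR'-sound D i c s h) (e₁ , e₂)
findR'-sound D i c (suc s) refl | false | false | false = record
  { positive = s≤s z≤n
  ; below    = ≮⇒≥ (λ lt → subst T s<i (<⇒<ᵇ lt))
  ; above    = ≤-refl
  ; empty    = not-¬ e₁ , not-¬ e₂
  ; rungs    = λ u s<u u<s → contradiction u<s (<⇒≱ s<u ∘ ≤-pred) }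
findR'-sound D i c (suc s) () | false | false | true
findR'-sound D i c (suc s) () | false | true  | false

findR'-complete : ∀ D i c s {r'} → LadderTarget D i c (suc s) r' → findR' D i c s ≡ just r'
findR'-complete D i c zero l =
  contradiction (LadderTarget.positive l) (<⇒≱ (LadderTarget.above l))
findR'-complete D i c (suc s) l with suc s <ᵇ i in s<i
... | true  = contradiction (≤-trans below (≤-pred above)) (<⇒≱ s<i′)
  where
  open LadderTarget l
  s<i′ : suc s < i
  s<i′ = <ᵇ⇒< (suc s) i (subst T (sym s<i) tt)
... | false with m≤n⇒m<n∨m≡n (≤-pred (LadderTarget.above l))
...   | inj₂ refl
  rewrite ¬-not (proj₁ (LadderTarget.empty l)) | ¬-not (proj₂ (LadderTarget.empty l)) = refl
...   | inj₁ r'<s with LadderTarget.rungs l (suc s) r'<s ≤-refl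
...     | s∈ , s∈′ rewrite s∈ | s∈′ =
  findR'-complete D i c s (LadderTarget-shorten l r'<s (n≤1+n _))

ladder-sound : ∀ D i r c {r'} → ladder D i r c ≡ just r' → LadderMove D i c r r'
ladder-sound D i r c h with (r , c) ∈ᵇ D in e₁ | (r , suc c) ∈ᵇ D in e₂
ladder-sound D i zero    c () | true | false
ladder-sound D i (suc r) c h  | true | false =
  record { source = e₁ ; source∉ = not-¬ e₂ ; target = findR'-sound D i c r h }
ladder-sound D i r c () | true  | true
ladder-sound D i r c () | false | true
ladder-sound D i r c () | false | false

ladder-complete : ∀ {D i c r r'} → LadderMove D i c r r' → ladder D i r c ≡ just r'
ladder-complete {r = zero} m = contradiction (LadderTarget.above (LadderMove.target m)) λ ()
ladder-complete {D} {i} {c} {suc r} m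
  rewrite LadderMove.source m | ¬-not (LadderMove.source∉ m) =
  findR'-complete D i c r (LadderMove.target m)

ladderStep : Diagram → ℕ → ℕ → ℕ → Diagram
ladderStep E c r r' = (r' , suc c) ∷ remove (r , c) E

column-suc≢ : ∀ {a b c : ℕ} → (a , suc c) ≢ (b , c)
column-suc≢ = 1+n≢n ∘ cong proj₂

module _ (E : Diagram) (c r r' : ℕ) where
  ∈-ladderStep⁺ : ∀ x → x ≢ (r , c) → x ∈D E → x ∈D ladderStep E c r r'
  ∈-ladderStep⁺ x x≢ x∈ = ∈D-there x (r' , suc c) (remove (r , c) E) (∈D-remove⁺ E x≢ x∈)

  ∈-ladderStep⁻ : ∀ x → x ∈D ladderStep E c r r' → x ≡ (r' , suc c) ⊎ x ∈D E
  ∈-ladderStep⁻ x x∈ with ∈D-∷⁻ {x} {r' , suc c} (remove (r , c) E) x∈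
  ... | inj₁ x≡  = inj₁ x≡
  ... | inj₂ x∈′ = inj₂ (∈D-remove⁻ (r , c) E x∈′)

  ladderStep-keeps-column-suc : ∀ a → (a , suc c) ∈D E → (a , suc c) ∈D ladderStep E c r r'
  ladderStep-keeps-column-suc a = ∈-ladderStep⁺ (a , suc c) column-suc≢

  ladderStep-column⁻ : ∀ a → (a , c) ∈D ladderStep E c r r' → (a , c) ∈D E
  ladderStep-column⁻ a a∈ with ∈-ladderStep⁻ (a , c) a∈
  ... | inj₁ a≡  = contradiction (sym a≡) column-suc≢
  ... | inj₂ a∈E = a∈E

LadderMove-ladderStep⁻ : ∀ {E i c r r' t s} → (r' , c) ∉D E → s ≢ r →
  LadderMove (ladderStep E c r r') i c t s → LadderMove E i c t s
LadderMove-ladderStep⁻ {E} {i} {c} {r} {r'} {t} {s} r'∉ s≢r m = record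
  { source  = ladderStep-column⁻ E c r r' t source
  ; source∉ = source∉ ∘ ladderStep-keeps-column-suc E c r r' t
  ; target  = record
    { positive = positive ; below = below ; above = above
    ; empty    = proj₁ empty ∘ ∈-ladderStep⁺ E c r r' (s , c) (s≢r ∘ cong proj₁)
               , proj₂ empty ∘ ladderStep-keeps-column-suc E c r r' s
    ; rungs    = λ u r'<u u<s → rung u (rungs u r'<u u<s) } }
  where
  open LadderMove m
  open LadderTarget target
  rung : ∀ u → FullRow (ladderStep E c r r') c u → FullRow E c u
  rung u (u∈ , u∈′) with ∈-ladderStep⁻ E c r r' (u , suc c) u∈′
  ... | inj₁ refl = contradiction (ladderStep-column⁻ E c r r' u u∈) r'∉
  ... | inj₂ u∈E′ = ladderStep-column⁻ E c r r' u u∈ , u∈E′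

ColumnFilled : Diagram → ℕ → ℕ → ℕ → Set
ColumnFilled E c i r = ∀ u → i ≤ u → u ≤ r → (u , c) ∈D E

LaddersSupported : ℕ → ℕ → Diagram → ℕ → Set
LaddersSupported i c E p =
  ∀ {t s} → p ≤ t → LadderMove E i c t s → ∀ u → i ≤ u → u < s → (u , suc c) ∈D E

LaddersSupported-suc : ∀ {i c E p} → LaddersSupported i c E p → LaddersSupported i c E (suc p)
LaddersSupported-suc supported p<t = supported (<⇒≤ p<t)

ColumnFilled-ladderStep : ∀ E c r r' {i a} →
  ColumnFilled E (suc c) i a → ColumnFilled (ladderStep E c r r') (suc c) i a
ColumnFilled-ladderStep E c r r' filled u i≤u u≤a =
  ladderStep-keeps-column-suc E c r r' u (filled u i≤u u≤a)

module _ {i c E r r'} (supported : LaddersSupported i c E r) (m : LadderMove E i c r r') where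
  open LadderTarget (LadderMove.target m)

  ladderStep-target-filled : ColumnFilled (ladderStep E c r r') (suc c) i r'
  ladderStep-target-filled u i≤u u≤r' with m≤n⇒m<n∨m≡n u≤r'
  ... | inj₁ u<r' = ladderStep-keeps-column-suc E c r r' u (supported ≤-refl m u i≤u u<r')
  ... | inj₂ refl = ∈D-here (u , suc c) (remove (r , c) E)

  ladderStep-supported : LaddersSupported i c (ladderStep E c r r') (suc r)
  ladderStep-supported {t} {s} r<t m′ u i≤u u<s with s ≟ r
  ... | no s≢r = ladderStep-keeps-column-suc E c r r' u
    (supported (<⇒≤ r<t) (LadderMove-ladderStep⁻ (proj₁ empty) s≢r m′) u i≤u u<s)
  ... | yes refl with u ≤? r'
  ...   | yes u≤r' = ladderStep-target-filled u i≤u u≤r'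
  ...   | no  u≰r' = ladderStep-keeps-column-suc E c r r' u (proj₂ (rungs u (≰⇒> u≰r') u<s))

applyUpTo-iterate : ∀ (f : ℕ → ℕ) p n → (∀ j → f j ≡ p + j) → applyUpTo f n ≡ iterate suc p n
applyUpTo-iterate f p zero    _ = refl
applyUpTo-iterate f p (suc n) f≗p+ = cong₂ _∷_ (trans (f≗p+ 0) (+-identityʳ p))
  (applyUpTo-iterate (f ∘ suc) (suc p) n (λ j → trans (f≗p+ (suc j)) (+-suc p j)))

rowsFrom-iterate : ∀ i D → rowsFrom i D ≡ iterate suc i (suc (maxRow D) ∸ i)
rowsFrom-iterate i D = trans (map-upTo (i +_) _) (applyUpTo-iterate (i +_) i _ λ _ → refl)

MovesFilled : ℕ → ℕ → Diagram → List Move → Set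
MovesFilled i c E = All (λ m → ColumnFilled E (suc c) i (proj₂ m))

scan-moves-filled : ∀ {i c} n p E ms → LaddersSupported i c E p → MovesFilled i c E ms →
  uncurry (MovesFilled i c) (scan i c (iterate suc p n) (E , ms))
scan-moves-filled zero p E ms _ filled = filled
scan-moves-filled {i} {c} (suc n) p E ms supported filled with ladder E i p c in eq
... | nothing = scan-moves-filled n (suc p) E ms (LaddersSupported-suc supported) filled
... | just r' = scan-moves-filled n (suc p) (ladderStep E c p r') ((p , r') ∷ ms)
  (ladderStep-supported supported m)
  (ladderStep-target-filled supported m ∷ All.map (ColumnFilled-ladderStep E c p r') filled)
  where
  m : LadderMove E i c p r'
  m = ladder-sound E i p c eq

Lrun-moves-filled : ∀ {i c D} → LaddersSupported i c D i → uncurry (MovesFilled i c) (Lrun i c D)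
Lrun-moves-filled {i} {c} {D} supported =
  subst (λ rows → uncurry (MovesFilled i c) (scan i c rows (D , [])))
        (sym (rowsFrom-iterate i D))
        (scan-moves-filled (suc (maxRow D) ∸ i) i D [] supported [])

Lrun-⊆-L : ∀ j c D x → x ∈D proj₁ (Lrun j c D) → x ∈D L j c D
Lrun-⊆-L j c D x x∈ with Lrun j c D
... | E , []          = x∈
... | E , (r , _) ∷ _ = ∈D-there x (r , c) E x∈

maxRow-≥ : ∀ D {t c} → (t , c) ∈D D → t ≤ maxRow D
maxRow-≥ ((a , b) ∷ D) {t} {c} t∈ with ∈D-∷⁻ {t , c} {a , b} D t∈
... | inj₁ refl = m≤m⊔n a (maxRow D)
... | inj₂ t∈D  = ≤-trans (maxRow-≥ D t∈D) (m≤n⊔m a (maxRow D))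

∈-rowsFrom : ∀ {j t} D → j ≤ t → t ≤ maxRow D → t ∈ rowsFrom j D
∈-rowsFrom {j} D j≤t t≤max = subst (_∈ rowsFrom j D) (m+[n∸m]≡n j≤t)
  (∈-map⁺ (j +_) (∈-upTo⁺ (∸-monoˡ-< (s≤s t≤max) j≤t)))

NewInColumn : ℕ → Diagram → Diagram → Set
NewInColumn c D E = ∃ λ a → (a , c) ∈D E × (a , c) ∉D D

scan-keeps-new : ∀ j c D rows E ms →
  NewInColumn (suc c) D E → NewInColumn (suc c) D (proj₁ (scan j c rows (E , ms)))
scan-keeps-new j c D [] E ms new = new
scan-keeps-new j c D (r ∷ rows) E ms new@(a , a∈E , a∉D) with ladder E j r c
... | nothing = scan-keeps-new j c D rows E ms new
... | just r' = scan-keeps-new j c D rows (ladderStep E c r r') ((r , r') ∷ ms)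
  (a , ladderStep-keeps-column-suc E c r r' a a∈E , a∉D)

scan-creates-new : ∀ j c D rows ms {t s} → t ∈ rows → ladder D j t c ≡ just s →
  NewInColumn (suc c) D (proj₁ (scan j c rows (D , ms)))
scan-creates-new j c D (r ∷ rows) ms t∈ t↦s with ladder D j r c in r↦
... | just r' = scan-keeps-new j c D rows (ladderStep D c r r') ((r , r') ∷ ms)
  (r' , ∈D-here (r' , suc c) (remove (r , c) D) ,
   proj₂ (LadderTarget.empty (LadderMove.target (ladder-sound D j r c r↦))))
... | nothing with t∈
...   | here refl  = contradiction (trans (sym r↦) t↦s) λ ()
...   | there t∈′ = scan-creates-new j c D rows ms t∈′ t↦s

L-adds-cell : ∀ {j c D t s} → LadderMove D j c t s → NewInColumn (suc c) D (L j c D)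
L-adds-cell {j} {c} {D} {t} m =
  let a , a∈ , a∉D = scan-creates-new j c D (rowsFrom j D) [] t∈rows (ladder-complete m)
  in  a , Lrun-⊆-L j c D (a , suc c) a∈ , a∉D
  where
  open LadderTarget (LadderMove.target m)
  t∈rows : t ∈ rowsFrom j D
  t∈rows = ∈-rowsFrom D (≤-trans below (<⇒≤ above)) (maxRow-≥ D (LadderMove.source m))

actsInitially⇒¬LadderMove : ∀ {i c D t s} → ActsInitially i c D → ¬ LadderMove D (suc i) c t s
actsInitially⇒¬LadderMove {i} {c} {D} initial m with L-adds-cell m
... | a , a∈L , a∉D = a∉D (trans (sym (initial (a , suc c))) a∈L)

actsInitially⇒LaddersSupported : ∀ {i c D} → ActsInitially i c D → LaddersSupported i c D i
actsInitially⇒LaddersSupported initial _ m u i≤u u<s =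
  contradiction (LadderMove-below (≤-<-trans i≤u u<s) m) (actsInitially⇒¬LadderMove initial)

lemma5p8 : (D : Diagram) (i c : ℕ) → 1 ≤ i → 1 ≤ c → Positive D →
    ActsInitially i c D →
    ∀ x → MovedTo i c D x → InInitialSegment i (suc c) (L i c D) x
lemma5p8 D i c _ _ _ initial x moved with ∈-map⁻ (λ (m : Move) → proj₂ m , suc c) moved
... | (r , r') , m∈ , refl =
  refl , λ u i≤u u≤r' → Lrun-⊆-L i c D (u , suc c) (All.lookup filled m∈ u i≤u u≤r')
  where
  filled : MovesFilled i c (proj₁ (Lrun i c D)) (proj₂ (Lrun i c D))
  filled = Lrun-moves-filled (actsInitially⇒LaddersSupported initial)
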